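{- Let $B$ be a set of time-constructible bounds with $\mathcal{B}_{\mathrm{lin}}\le_a B$ such that $B\cup\{\beta_{\mathrm{id}}\}$ is tame. Then $B$ is regular if and only if $\{\beta\circ\beta:\beta\in B\}\le_a B$.
   Context: A (time) bound is $\beta:\mathbb{N}\to\mathbb{N}$ with $n\le\beta(n)\le\beta(n+1)$; $\beta_{\mathrm{id}}(n)=n$. $f\le_a g$: $f(n)\le g(n)$ for almost all $n$; for sets, $B_1\le_a B_2$: every element of $B_1$ is $\le_a$ some element of $B_2$. $\mathcal{B}_{\mathrm{lin}}=\{c\cdot n:c\in\mathbb{N}^+\}$. A bound $\beta$ is time-constructible if $w\mapsto1^{\beta(|w|)}$ ($w\in\{0,1\}^*$) is computable by a deterministic multitape Turing machine with output tape in time $O(\beta(|w|))$. A nonempty set $B$ of bounds is regular if (i) each $\beta\in B$ satisfies $\beta\le_a\beta'$ for some time-constructible $\beta'\in B$, and (ii) for all $\beta,\beta'\in B$ there is $\beta''\in B$ with $\beta+\beta'\circ\beta\le_a\beta''$. A set $U$ of bounds is tame if for all $\beta_1,\beta_2\in U$ the limit $\lim_{n\to\infty,n>0}\beta_1(n)/\beta_2(n)$ exists in $\mathbb{R}\cup\{\infty\}$. -}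

module Defs where

open import Data.Nat using (ℕ; zero; suc; _+_; _*_; _≤_; _<_; _≡ᵇ_; ∣_-_∣)
open import Data.Bool using (Bool; true; false; if_then_else_)
open import Data.Maybe using (Maybe; just; nothing)
open import Data.Fin using (Fin)
open import Data.Vec using (Vec; zipWith; replicate; map)
open import Data.List using (List; length; lookup; _++_; [_])
import Data.List as L
open import Data.Product using (Σ; ∃; ∃-syntax; _×_; _,_)
open import Data.Sum using (_⊎_)
open import Relation.Binary.PropositionalEquality using (_≡_)

Fun : Set
Fun = ℕ → ℕ

IsBound : Fun → Set
IsBound β = (∀ n → n ≤ β n) × (∀ n → β n ≤ β (suc n))

βid : Fun
βid n = n

SetOfFuns : Set₁
SetOfFuns = Fun → Set

_≤ₐ_ : Fun → Fun → Set
f ≤ₐ g = ∃[ N ] (∀ n → N ≤ n → f n ≤ g n)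

_≤ₐˢ_ : SetOfFuns → SetOfFuns → Set
B₁ ≤ₐˢ B₂ = ∀ f → B₁ f → ∃[ g ] (B₂ g × f ≤ₐ g)

Blin : SetOfFuns
Blin f = ∃[ c ] ((1 ≤ c) × (∀ n → f n ≡ c * n))

Squares : SetOfFuns → SetOfFuns
Squares B f = ∃[ β ] (B β × (∀ n → f n ≡ β (β n)))

_∪id : SetOfFuns → SetOfFuns
(B ∪id) f = B f ⊎ (∀ n → f n ≡ n)

-- Deterministic multitape Turing machines with read-only input tape,
-- k work tapes and a write-only output tape (head moving right after
-- each written symbol).  Tapes are one-way infinite to the right;
-- a left move at cell 0 stays at cell 0.  Work-tape symbols are
-- Fin (suc g), with zero the blank.  Input symbols are bits, with
-- nothing denoting a blank cell beyond the input.

data Move : Set where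
  left stay right : Move

move : Move → ℕ → ℕ
move left zero = zero
move left (suc p) = p
move stay p = p
move right p = suc p

record TM : Set where
  field
    nQ     : ℕ
    k      : ℕ
    g      : ℕ
    start  : Fin nQ
    halts  : Fin nQ → Bool
    δ      : Fin nQ → Maybe Bool → Vec (Fin (suc g)) k →
             Fin nQ × Move × Vec (Fin (suc g) × Move) k × Maybe Bool
             -- new state, input head move, (write, move) per work tape,
             -- optional output bit to write

record Config (M : TM) : Set where
  constructor cfg
  open TM M
  field
    state  : Fin nQ
    inPos  : ℕ
    tapes  : Vec (ℕ → Fin (suc g)) k
    heads  : Vec ℕ k
    output : List Bool

readInput : List Bool → ℕ → Maybe Bool
readInput L.[] _ = nothing
readInput (b L.∷ _) zero = just b
readInput (_ L.∷ bs) (suc i) = readInput bs i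

writeCell : {A : Set} → (ℕ → A) → ℕ → A → (ℕ → A)
writeCell t p a i = if i ≡ᵇ p then a else t i

appendOut : List Bool → Maybe Bool → List Bool
appendOut o nothing = o
appendOut o (just b) = o ++ [ b ]

initConfig : (M : TM) → Config M
initConfig M = cfg (TM.start M) 0 (replicate _ (λ _ → Fin.zero)) (replicate _ 0) L.[]
  where import Data.Fin as Fin

step : (M : TM) → List Bool → Config M → Config M
step M w c with TM.halts M (Config.state c)
... | true = c
... | false with TM.δ M (Config.state c) (readInput w (Config.inPos c))
                   (zipWith (λ t p → t p) (Config.tapes c) (Config.heads c))
... | (q' , mi , acts , out) =
  cfg q' (move mi (Config.inPos c))
      (zipWith (λ tp a → writeCell (Data.Product.proj₁ tp) (Data.Product.proj₂ tp) (Data.Product.proj₁ a))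
               (zipWith _,_ (Config.tapes c) (Config.heads c)) acts)
      (zipWith (λ p a → move (Data.Product.proj₂ a) p) (Config.heads c) acts)
      (appendOut (Config.output c) out)
  where import Data.Product

run : (M : TM) → List Bool → ℕ → Config M
run M w zero = initConfig M
run M w (suc t) = step M w (run M w t)

HaltsWith : (M : TM) → List Bool → ℕ → List Bool → Set
HaltsWith M w t o =
  (TM.halts M (Config.state (run M w t)) ≡ true) × (Config.output (run M w t) ≡ o)

TimeConstructible : Fun → Set
TimeConstructible β =
  ∃[ M ] ∃[ c ] ∃[ N ]
    ((∀ w → ∃[ t ] HaltsWith M w t (L.replicate (β (length w)) true)) ×
     (∀ w → N ≤ length w → ∃[ t ] (t ≤ c * β (length w) ×
                                   HaltsWith M w t (L.replicate (β (length w)) true))))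

NonEmpty : SetOfFuns → Set
NonEmpty B = ∃[ β ] B β

IsRegular : SetOfFuns → Set
IsRegular B =
  NonEmpty B ×
  (∀ β → B β → ∃[ β' ] (B β' × TimeConstructible β' × β ≤ₐ β')) ×
  (∀ β β' → B β → B β' → ∃[ β'' ] (B β'' × (λ n → β n + β' (β n)) ≤ₐ β''))

-- Limits of ratios a(n)/b(n) (n > 0) in ℝ ∪ {∞}.
-- Since there are no reals, convergence to a real number is expressed by
-- the Cauchy criterion (equivalent, by completeness of ℝ), with ε = 1/(k+1)
-- and fractions cross-multiplied:
--   |a m / b m - a n / b n| < 1/(k+1)  ⟺  (k+1)·|a m·b n − a n·b m| < b m·b n
-- Divergence to ∞: for every M, eventually M < a n / b n, i.e. M·b n < a n.

RatioCauchy : Fun → Fun → Set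
RatioCauchy a b =
  ∀ k → ∃[ N ] (∀ m n → N ≤ m → N ≤ n → 1 ≤ m → 1 ≤ n →
     suc k * ∣ a m * b n - a n * b m ∣ < b m * b n)

RatioDiverges : Fun → Fun → Set
RatioDiverges a b =
  ∀ M → ∃[ N ] (∀ n → N ≤ n → 1 ≤ n → M * b n < a n)

RatioLimitExists : Fun → Fun → Set
RatioLimitExists a b = RatioCauchy a b ⊎ RatioDiverges a b

IsTame : SetOfFuns → Set
IsTame U = ∀ β₁ β₂ → U β₁ → U β₂ → RatioLimitExists β₁ β₂

module Submission where

open import Defs
open import Data.Nat using (suc; _+_; _*_; >-nonZero; _≤_; _≤′_; ≤′-refl; ≤′-step; _⊔_; z≤n; s≤s; ∣_-_∣)
open import Data.Nat.Properties
open import Data.Product using (_×_; _,_; proj₁; ∃-syntax)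
open import Data.Sum using (inj₁; inj₂)
open import Function using (_∘_)
open import Function.Bundles using (_⇔_; mk⇔)
open import Relation.Binary.Bundles using (Preorder)
open import Relation.Binary.PropositionalEquality
  using (_≡_; refl; sym; cong; subst; isEquivalence)
import Relation.Binary.Reasoning.Preorder as PreorderReasoning

-- If B dominates the squares β ∘ β, then it also dominates the multiples c·δ of
-- its elements: by tameness either δ(n)/n has a finite limit, so c·δ is
-- eventually linear and dominated via B_lin ≤ₐ B, or δ(n)/n → ∞, so that
-- c·δ(n) ≤ δ(δ(n)) eventually.  Tameness of β/β' then gives a common upper
-- bound δ ∈ B of any β, β' ∈ B, and β + β' ∘ β ≤ₐ 2·(δ ∘ δ) is dominated by B.

private
  variable
    f g h f' g' : Fun

IsBound⇒monotone : ∀ {β} → IsBound β → ∀ {m n} → m ≤ n → β m ≤ β n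
IsBound⇒monotone {β} (_ , step) m≤n = go (≤⇒≤′ m≤n)
  where
  go : ∀ {m n} → m ≤′ n → β m ≤ β n
  go ≤′-refl         = ≤-refl
  go (≤′-step m≤′n) = ≤-trans (go m≤′n) (step _)

≤⇒≤ₐ : (∀ n → f n ≤ g n) → f ≤ₐ g
≤⇒≤ₐ f≤g = 0 , λ n _ → f≤g n

≤ₐ-refl : f ≤ₐ f
≤ₐ-refl = ≤⇒≤ₐ λ _ → ≤-refl

≤ₐ-trans : f ≤ₐ g → g ≤ₐ h → f ≤ₐ h
≤ₐ-trans (M , f≤g) (N , g≤h) =
  M ⊔ N , λ n p → ≤-trans (f≤g n (m⊔n≤o⇒m≤o M N p)) (g≤h n (m⊔n≤o⇒n≤o M N p))

≤ₐ-preorder : Preorder _ _ _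
≤ₐ-preorder = record
  { Carrier    = Fun
  ; _≈_        = _≡_
  ; _≲_        = _≤ₐ_
  ; isPreorder = record
    { isEquivalence = isEquivalence
    ; reflexive     = λ { refl → ≤ₐ-refl }
    ; trans         = ≤ₐ-trans
    }
  }

+-mono-≤ₐ : f ≤ₐ g → f' ≤ₐ g' → (λ n → f n + f' n) ≤ₐ (λ n → g n + g' n)
+-mono-≤ₐ (M , f≤g) (N , f'≤g') =
  M ⊔ N , λ n p → +-mono-≤ (f≤g n (m⊔n≤o⇒m≤o M N p)) (f'≤g' n (m⊔n≤o⇒n≤o M N p))

*-monoʳ-≤ₐ : ∀ c → f ≤ₐ g → (λ n → c * f n) ≤ₐ (λ n → c * g n)
*-monoʳ-≤ₐ c (N , f≤g) = N , λ n p → *-monoʳ-≤ c (f≤g n p)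

∘-monoˡ-≤ₐ : (∀ n → n ≤ h n) → f ≤ₐ g → (f ∘ h) ≤ₐ (g ∘ h)
∘-monoˡ-≤ₐ {h = h} inflationary (N , f≤g) =
  N , λ n p → f≤g (h n) (≤-trans p (inflationary n))

∘-monoʳ-≤ₐ : (∀ {m n} → m ≤ n → h m ≤ h n) → f ≤ₐ g → (h ∘ f) ≤ₐ (h ∘ g)
∘-monoʳ-≤ₐ monotone (N , f≤g) = N , λ n p → monotone (f≤g n p)

RatioCauchy⇒≤ₐ-multiple : ∀ {a b} → (∀ n → 1 ≤ n → 1 ≤ b n) → RatioCauchy a b →
                           ∃[ C ] a ≤ₐ (λ n → C * b n)
RatioCauchy⇒≤ₐ-multiple {a} {b} b-positive cauchy
  with N , close ← cauchy 0 =
  a m + b m , m , bound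
  where
  m = suc N

  bound : ∀ n → m ≤ n → a n ≤ (a m + b m) * b n
  bound n m≤n = begin
    a n                              ≤⟨ m≤m*n (a n) (b m) {{>-nonZero (b-positive m (s≤s z≤n))}} ⟩
    a n * b m                        ≤⟨ m≤n+∣n-m∣ (a n * b m) (a m * b n) ⟩
    a m * b n + ∣ a m * b n - a n * b m ∣ ≤⟨ +-monoʳ-≤ (a m * b n) distance≤ ⟩
    a m * b n + b m * b n            ≡⟨ *-distribʳ-+ (b n) (a m) (b m) ⟨
    (a m + b m) * b n                ∎
    where
    open ≤-Reasoning
    n≥1 = ≤-trans (s≤s z≤n) m≤n
    distance≤ : ∣ a m * b n - a n * b m ∣ ≤ b m * b n
    distance≤ = subst (_≤ b m * b n) (+-identityʳ _)
      (<⇒≤ (close m n (n≤1+n N) (≤-trans (n≤1+n N) m≤n) (s≤s z≤n) n≥1))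

RatioDiverges⇒multiple-≤ₐ : ∀ {a b} → RatioDiverges a b → ∀ M → (λ n → M * b n) ≤ₐ a
RatioDiverges⇒multiple-≤ₐ divergent M with N , above ← divergent M =
  N ⊔ 1 , λ n p → <⇒≤ (above n (m⊔n≤o⇒m≤o N 1 p) (m⊔n≤o⇒n≤o N 1 p))

regular⇒squares-≤ₐˢ : ∀ {B} → IsRegular B → Squares B ≤ₐˢ B
regular⇒squares-≤ₐˢ (_ , _ , composite) f (β , Bβ , f≡β∘β)
  with β'' , Bβ'' , β+β∘β≤β'' ← composite β β Bβ Bβ =
  β'' , Bβ'' , ≤ₐ-trans (≤⇒≤ₐ λ n → subst (_≤ β n + β (β n)) (sym (f≡β∘β n))
                                           (m≤n+m (β (β n)) (β n)))
                        β+β∘β≤β''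

Blin-≤ₐˢ⇒nonEmpty : ∀ {B} → Blin ≤ₐˢ B → NonEmpty B
Blin-≤ₐˢ⇒nonEmpty lin with β , Bβ , _ ← lin (1 *_) (1 , s≤s z≤n , λ _ → refl) = β , Bβ

module SquareClosed (B : SetOfFuns)
    (bound : ∀ β → B β → IsBound β)
    (lin : Blin ≤ₐˢ B)
    (tame : IsTame (B ∪id))
    (squares : Squares B ≤ₐˢ B) where

  open PreorderReasoning ≤ₐ-preorder using (begin_; step-≲; _∎)

  inflationary : ∀ {β} → B β → ∀ n → n ≤ β n
  inflationary Bβ = proj₁ (bound _ Bβ)

  monotone : ∀ {β} → B β → ∀ {m n} → m ≤ n → β m ≤ β n
  monotone Bβ = IsBound⇒monotone (bound _ Bβ)

  linear-≤ₐ-B : ∀ c → ∃[ ε ] (B ε × (λ n → c * n) ≤ₐ ε)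
  linear-≤ₐ-B c with ε , Bε , suc-c≤ε ← lin _ (suc c , s≤s z≤n , λ _ → refl) =
    ε , Bε , ≤ₐ-trans (≤⇒≤ₐ λ n → *-monoˡ-≤ n (n≤1+n c)) suc-c≤ε

  square-≤ₐ-B : ∀ {δ} → B δ → ∃[ ε ] (B ε × (δ ∘ δ) ≤ₐ ε)
  square-≤ₐ-B {δ} Bδ = squares (δ ∘ δ) (δ , Bδ , λ _ → refl)

  multiple-≤ₐ-B : ∀ {δ} → B δ → ∀ c → ∃[ ε ] (B ε × (λ n → c * δ n) ≤ₐ ε)
  multiple-≤ₐ-B {δ} Bδ c with tame δ βid (inj₁ Bδ) (inj₂ λ _ → refl)
  ... | inj₁ cauchy
    with C , δ≤C·n ← RatioCauchy⇒≤ₐ-multiple (λ _ n≥1 → n≥1) cauchy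
    with ε , Bε , cC·n≤ε ← linear-≤ₐ-B (c * C) =
    ε , Bε , (begin
      (λ n → c * δ n)     ≲⟨ *-monoʳ-≤ₐ c δ≤C·n ⟩
      (λ n → c * (C * n)) ≲⟨ ≤⇒≤ₐ (λ n → ≤-reflexive (sym (*-assoc c C n))) ⟩
      (λ n → c * C * n)   ≲⟨ cC·n≤ε ⟩
      ε                   ∎)
  ... | inj₂ divergent with ε , Bε , δ∘δ≤ε ← square-≤ₐ-B Bδ =
    ε , Bε , (begin
      (λ n → c * δ n) ≲⟨ ∘-monoˡ-≤ₐ (inflationary Bδ) (RatioDiverges⇒multiple-≤ₐ divergent c) ⟩
      δ ∘ δ           ≲⟨ δ∘δ≤ε ⟩
      ε               ∎)

  upper-bound-B : ∀ {β β'} → B β → B β' → ∃[ δ ] (B δ × β ≤ₐ δ × β' ≤ₐ δ)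
  upper-bound-B {β} {β'} Bβ Bβ' with tame β β' (inj₁ Bβ) (inj₁ Bβ')
  ... | inj₁ cauchy
    with C , β≤C·β' ← RatioCauchy⇒≤ₐ-multiple (λ n n≥1 → ≤-trans n≥1 (inflationary Bβ' n)) cauchy
    with ε , Bε , sucC·β'≤ε ← multiple-≤ₐ-B Bβ' (suc C) =
    ε , Bε
      , ≤ₐ-trans β≤C·β' (≤ₐ-trans (≤⇒≤ₐ λ n → *-monoˡ-≤ (β' n) (n≤1+n C)) sucC·β'≤ε)
      , ≤ₐ-trans (≤⇒≤ₐ λ n → m≤m+n (β' n) (C * β' n)) sucC·β'≤ε
  ... | inj₂ divergent =
    β , Bβ , ≤ₐ-refl
      , ≤ₐ-trans (≤⇒≤ₐ λ n → ≤-reflexive (sym (*-identityˡ (β' n))))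
                 (RatioDiverges⇒multiple-≤ₐ divergent 1)

  composite-≤ₐ-B : ∀ {β β'} → B β → B β' → ∃[ β'' ] (B β'' × (λ n → β n + β' (β n)) ≤ₐ β'')
  composite-≤ₐ-B {β} {β'} Bβ Bβ'
    with δ , Bδ , β≤δ , β'≤δ ← upper-bound-B Bβ Bβ'
    with ε , Bε , δ∘δ≤ε ← square-≤ₐ-B Bδ
    with ζ , Bζ , 2ε≤ζ ← multiple-≤ₐ-B Bε 2 =
    ζ , Bζ , (begin
      (λ n → β n + β' (β n))     ≲⟨ +-mono-≤ₐ β≤δ∘δ β'∘β≤δ∘δ ⟩
      (λ n → δ (δ n) + δ (δ n)) ≲⟨ +-mono-≤ₐ δ∘δ≤ε δ∘δ≤ε ⟩
      (λ n → ε n + ε n)         ≲⟨ ≤⇒≤ₐ (λ n → ≤-reflexive (cong (ε n +_) (sym (+-identityʳ (ε n))))) ⟩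
      (λ n → 2 * ε n)           ≲⟨ 2ε≤ζ ⟩
      ζ                         ∎)
    where
    β≤δ∘δ : β ≤ₐ (δ ∘ δ)
    β≤δ∘δ = ≤ₐ-trans β≤δ (≤⇒≤ₐ λ n → monotone Bδ (inflationary Bδ n))
    β'∘β≤δ∘δ : (β' ∘ β) ≤ₐ (δ ∘ δ)
    β'∘β≤δ∘δ = ≤ₐ-trans (∘-monoˡ-≤ₐ (inflationary Bβ) β'≤δ) (∘-monoʳ-≤ₐ (monotone Bδ) β≤δ)

proposition1 : (B : SetOfFuns) →
    (∀ β → B β → IsBound β) →
    (∀ β → B β → TimeConstructible β) →
    Blin ≤ₐˢ B →
    IsTame (B ∪id) →
    IsRegular B ⇔ (Squares B ≤ₐˢ B)
proposition1 B bound constructible lin tame = mk⇔ regular⇒squares-≤ₐˢ squares⇒regular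
  where
  squares⇒regular : Squares B ≤ₐˢ B → IsRegular B
  squares⇒regular squares =
    Blin-≤ₐˢ⇒nonEmpty lin
    , (λ β Bβ → β , Bβ , constructible β Bβ , ≤ₐ-refl)
    , (λ β β' → composite-≤ₐ-B)
    where open SquareClosed B bound lin tame squares
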